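{- There exists an absolute constant $c>0$ such that for every integer $k\geq1$ and every integer $n$ sufficiently large relative to $k$, $s_k(n)\geq c\,kn\log n$.
   Context: A graph $U$ contains a graph $G$ if some subgraph of $U$ is isomorphic to $G$. For integers $k\geq1$ and $n\geq1$, $s_k(n)$ denotes the minimum number of edges in a graph that contains every graph with $n$ vertices and treewidth at most $k$. -}

module Defs where

open import Data.Nat using (ℕ; zero; suc; _+_; _<ᵇ_)
open import Data.Bool using (Bool; true; false; if_then_else_; _∧_)
open import Data.Fin using (Fin; zero; suc; toℕ; inject₁; fromℕ)
open import Data.Fin.Subset using (Subset; _∈_; ∣_∣)
open import Data.Product using (Σ; _×_; _,_)
open import Data.Unit using (⊤)
open import Data.Empty using (⊥)
open import Relation.Binary.PropositionalEquality using (_≡_)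
open import Function.Definitions using (Injective)
open import Relation.Nullary using (¬_)

record Graph (n : ℕ) : Set where
  field
    adj    : Fin n → Fin n → Bool
    sym    : ∀ i j → adj i j ≡ adj j i
    irrefl : ∀ i → adj i i ≡ false
open Graph public

Adj : ∀ {n} → Graph n → Fin n → Fin n → Set
Adj G i j = adj G i j ≡ true

sumFin : ∀ {n} → (Fin n → ℕ) → ℕ
sumFin {zero}  f = 0
sumFin {suc n} f = f zero + sumFin (λ i → f (suc i))

edgeCount : ∀ {n} → Graph n → ℕ
edgeCount G = sumFin (λ i → sumFin (λ j →
  if (toℕ i <ᵇ toℕ j) ∧ adj G i j then 1 else 0))

-- U contains G: some subgraph of U is isomorphic to G, i.e. there is an
-- injective vertex map sending edges of G to edges of U.
Contains : ∀ {m n} → Graph m → Graph n → Set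
Contains {m} {n} U G =
  Σ (Fin n → Fin m) λ f → Injective _≡_ _≡_ f × (∀ i j → Adj G i j → Adj U (f i) (f j))

data Walk {n : ℕ} (G : Graph n) (P : Fin n → Set) : Fin n → Fin n → Set where
  here : ∀ {u} → P u → Walk G P u u
  step : ∀ {u w v} → P u → Adj G u w → Walk G P w v → Walk G P u v

Connected : ∀ {n} → Graph n → Set
Connected G = ∀ u v → Walk G (λ _ → ⊤) u v

HasCycle : ∀ {n} → Graph n → Set
HasCycle {n} G = Σ ℕ λ r → Σ (Fin (3 + r) → Fin n) λ c →
  Injective _≡_ _≡_ c ×
  ((∀ (i : Fin (2 + r)) → Adj G (c (inject₁ i)) (c (suc i))) ×
   Adj G (c (fromℕ (2 + r))) (c zero))

IsTree : ∀ {t} → Graph t → Set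
IsTree T = Connected T × ¬ HasCycle T

record TreeDecomposition {n : ℕ} (k : ℕ) (G : Graph n) : Set where
  field
    t         : ℕ
    T         : Graph t
    isTree    : IsTree T
    bag       : Fin t → Subset n
    bagSize   : ∀ x → ∣ bag x ∣ Data.Nat.≤ suc k
    vertexCov : ∀ v → Σ (Fin t) λ x → v ∈ bag x
    edgeCov   : ∀ u v → Adj G u v → Σ (Fin t) λ x → (u ∈ bag x × v ∈ bag x)
    -- the nodes whose bags contain v induce a connected subtree
    coherent  : ∀ v x y → v ∈ bag x → v ∈ bag y → Walk T (λ z → v ∈ bag z) x y

TreewidthAtMost : ∀ {n} → ℕ → Graph n → Set
TreewidthAtMost k G = TreeDecomposition k G

Universal : ∀ {m} → ℕ → (n : ℕ) → Graph m → Set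
Universal k n U = ∀ (G : Graph n) → TreewidthAtMost k G → Contains U G

-- Split the n vertices into blocks of size b = 2^(i+2) and join the first k vertices of each block
-- (its heads) to all other vertices of the block. Along the path 0 − 1 − … − (n−1), the bags
-- {z} ∪ {heads of the block of z} form a tree decomposition of width k, and the roughly n k / b heads
-- have degree at least b − k ≥ 2^(i+1). A graph U containing all these graphs therefore has at
-- least n k / 2^(i+3) vertices of degree at least 2^(i+1), for each of the ≈ log₂ n − k scales
-- i ≥ k. Weighting scale i by 2^i, a vertex of degree d is charged at most d in total, so
-- 2 e(U) = Σ deg ≥ (log₂ n − k) n k / 8, which is at least n k log₂ n / 16 once n ≥ 4^(k+1).
module Submission where

open import Defs hiding (sym)

open import Data.Bool using (Bool; true; false; if_then_else_; _∧_)
open import Data.Bool.Properties using (T-≡)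
open import Data.Fin using (Fin; zero; suc; toℕ; fromℕ; fromℕ<; inject₁; lower₁; remQuot; combine)
  renaming (_≟_ to _≟ᶠ_)
import Data.Fin.Properties as Finₚ
open import Data.Fin.Subset using (Subset; _∈_; ∣_∣)
open import Data.List using (allFin)
open import Data.List.Extrema.Nat using (argmax; f[xs]≤f[argmax])
open import Data.List.Membership.Propositional.Properties using (∈-allFin)
import Data.List.Relation.Unary.All as All
open import Data.Nat
open import Data.Nat.DivMod
open import Data.Nat.Induction using (<-rec)
open import Data.Nat.Logarithm
open import Data.Nat.Properties
open import Data.Nat.Tactic.RingSolver using (solve-∀)
open import Data.Product using (Σ; _×_; _,_; proj₁; proj₂; uncurry)
open import Data.Sum using (_⊎_; inj₁; inj₂)
import Data.Sum as Sum
open import Data.Unit using (tt)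
open import Data.Vec using (tabulate)
open import Data.Vec.Properties using (lookup∘tabulate; lookup⇒[]=; []=⇒lookup)
open import Data.Vec.Functional using (updateAt)
open import Data.Vec.Functional.Properties using (updateAt-minimal)
open import Function using (_∘_)
open import Function.Bundles using (Equivalence)
open import Relation.Binary using (Decidable; Symmetric; tri<; tri≈; tri>)
open import Relation.Binary.PropositionalEquality
open import Relation.Nullary using (Dec; yes; no; does; ¬_; contradiction)
open import Relation.Nullary.Decidable using (dec-true; dec-false; _⊎-dec_; _×-dec_; ¬?)

open import Algebra.Properties.CommutativeSemigroup +-commutativeSemigroup using (x∙yz≈y∙xz)
open import Algebra.Properties.Semiring.Sum +-*-semiring
  using (sum; sum-cong-≗; ∑-distrib-+; ∑-comm; *-distribˡ-sum)

𝟙 : Bool → ℕ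
𝟙 b = if b then 1 else 0

-- Not defined as 𝟙 (does P?): that would reduce to a Boolean test, and `with P?` could no longer
-- abstract over it.
𝟙[_] : ∀ {P : Set} → Dec P → ℕ
𝟙[ yes _ ] = 1
𝟙[ no  _ ] = 0

1≤𝟙[_] : ∀ {P : Set} (P? : Dec P) → P → 1 ≤ 𝟙[ P? ]
1≤𝟙[ yes _ ] _ = ≤-refl
1≤𝟙[ no ¬p ] p = contradiction p ¬p

𝟙≤1 : ∀ b → 𝟙 b ≤ 1
𝟙≤1 false = z≤n
𝟙≤1 true  = ≤-refl

𝟙-positive : ∀ {b} → 0 < 𝟙 b → b ≡ true
𝟙-positive {true} _ = refl

does⇒witness : ∀ {P : Set} (P? : Dec P) → does P? ≡ true → P
does⇒witness (yes p) _ = p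

sumFin≡sum : ∀ {n} (f : Fin n → ℕ) → sumFin f ≡ sum f
sumFin≡sum {zero}  f = refl
sumFin≡sum {suc n} f = cong (f zero +_) (sumFin≡sum (λ i → f (suc i)))

sum-mono-≤ : ∀ {n} {f g : Fin n → ℕ} → (∀ i → f i ≤ g i) → sum f ≤ sum g
sum-mono-≤ {zero}  f≤g = z≤n
sum-mono-≤ {suc n} f≤g = +-mono-≤ (f≤g zero) (sum-mono-≤ (λ i → f≤g (suc i)))

sum-const : ∀ n c → sum {n} (λ _ → c) ≡ n * c
sum-const zero    c = refl
sum-const (suc n) c = cong (c +_) (sum-const n c)

sum-updateAt-0 : ∀ {n} (h : Fin n → ℕ) y → sum h ≡ h y + sum (updateAt h y (λ _ → 0))
sum-updateAt-0 {suc n} h zero    = refl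
sum-updateAt-0 {suc n} h (suc y) = begin
  h zero + sum (λ i → h (suc i))
    ≡⟨ cong (h zero +_) (sum-updateAt-0 (λ i → h (suc i)) y) ⟩
  h zero + (h (suc y) + sum (updateAt (λ i → h (suc i)) y (λ _ → 0)))
    ≡⟨ x∙yz≈y∙xz (h zero) (h (suc y)) _ ⟩
  h (suc y) + (h zero + sum (updateAt (λ i → h (suc i)) y (λ _ → 0))) ∎
  where open ≡-Reasoning

∣tabulate∣≡sum : ∀ {n} (f : Fin n → Bool) → ∣ tabulate f ∣ ≡ sum (λ i → 𝟙 (f i))
∣tabulate∣≡sum {zero}  f = refl
∣tabulate∣≡sum {suc n} f with f zero
... | true  = cong suc (∣tabulate∣≡sum (λ i → f (suc i)))
... | false = ∣tabulate∣≡sum (λ i → f (suc i))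

sum-≤-injection : ∀ {a m} (f : Fin a → Fin m) (g : Fin a → ℕ) (h : Fin m → ℕ) →
  (∀ {x y} → 0 < g x → 0 < g y → f x ≡ f y → x ≡ y) →
  (∀ x → g x ≤ h (f x)) → sum g ≤ sum h
sum-≤-injection {zero}  f g h inj g≤hf = z≤n
sum-≤-injection {suc a} f g h inj g≤hf with g zero in g₀
... | zero  = sum-≤-injection (λ x → f (suc x)) (λ x → g (suc x)) h
                (λ gx gy e → Finₚ.suc-injective (inj gx gy e)) (λ x → g≤hf (suc x))
... | suc g₀-1 = begin
  suc g₀-1 + sum (λ x → g (suc x))
    ≤⟨ +-mono-≤ (subst (_≤ _) g₀ (g≤hf zero)) rest ⟩
  h (f zero) + sum h′
    ≡⟨ sum-updateAt-0 h (f zero) ⟨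
  sum h ∎
  where
  open ≤-Reasoning
  h′ = updateAt h (f zero) (λ _ → 0)
  g≤h′f : ∀ x → g (suc x) ≤ h′ (f (suc x))
  g≤h′f x with g (suc x) in gₓ
  ... | zero  = z≤n
  ... | suc _ = subst (_ ≤_) (sym (updateAt-minimal _ _ h fx≢f₀)) (subst (_≤ _) gₓ (g≤hf (suc x)))
    where
    fx≢f₀ : f (suc x) ≢ f zero
    fx≢f₀ e with inj {suc x} {zero} (subst (0 <_) (sym gₓ) z<s) (subst (0 <_) (sym g₀) z<s) e
    ... | ()
  rest : sum (λ x → g (suc x)) ≤ sum h′
  rest = sum-≤-injection (λ x → f (suc x)) (λ x → g (suc x)) h′
           (λ gx gy e → Finₚ.suc-injective (inj gx gy e)) g≤h′f

injection⇒≤sum : ∀ {a m} (f : Fin a → Fin m) (h : Fin m → ℕ) →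
  (∀ {x y} → f x ≡ f y → x ≡ y) → (∀ x → 1 ≤ h (f x)) → a ≤ sum h
injection⇒≤sum {a} f h f-inj 1≤hf = begin
  a                    ≡⟨ *-identityʳ a ⟨
  a * 1                ≡⟨ sum-const a 1 ⟨
  sum {a} (λ _ → 1)    ≤⟨ sum-≤-injection f (λ _ → 1) h (λ _ _ → f-inj) 1≤hf ⟩
  sum h ∎
  where open ≤-Reasoning

degree : ∀ {n} → Graph n → Fin n → ℕ
degree G v = sum λ w → 𝟙 (adj G v w)

orderedEdge : ∀ {n} → Graph n → Fin n → Fin n → ℕ
orderedEdge G i j = 𝟙 ((toℕ i <ᵇ toℕ j) ∧ adj G i j)

edgeCount≡sum : ∀ {n} (G : Graph n) → edgeCount G ≡ sum (λ i → sum (orderedEdge G i))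
edgeCount≡sum G = trans (sumFin≡sum (λ i → sumFin (orderedEdge G i))) (sum-cong-≗ (λ i → sumFin≡sum (orderedEdge G i)))

𝟙-adj≤orderedEdges : ∀ {n} (G : Graph n) i j → 𝟙 (adj G i j) ≤ orderedEdge G i j + orderedEdge G j i
𝟙-adj≤orderedEdges G i j with adj G i j in i~j | <-cmp (toℕ i) (toℕ j)
... | false | _ = z≤n
... | true | tri< i<j _ _ rewrite Equivalence.to T-≡ (<⇒<ᵇ i<j) = s≤s z≤n
... | true | tri> _ _ j<i rewrite Equivalence.to T-≡ (<⇒<ᵇ j<i) | trans (Graph.sym G j i) i~j = m≤n+m 1 _
... | true | tri≈ _ i≡j _ with refl ← Finₚ.toℕ-injective i≡j with () ← trans (sym i~j) (irrefl G i)

sum-degree≤2*edgeCount : ∀ {n} (G : Graph n) → sum (degree G) ≤ 2 * edgeCount G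
sum-degree≤2*edgeCount G = begin
  sum (degree G)
    ≤⟨ sum-mono-≤ (λ i → sum-mono-≤ (λ j → 𝟙-adj≤orderedEdges G i j)) ⟩
  sum (λ i → sum (λ j → E i j + E j i))
    ≡⟨ sum-cong-≗ (λ i → ∑-distrib-+ (E i) (λ j → E j i)) ⟩
  sum (λ i → sum (E i) + sum (λ j → E j i))
    ≡⟨ ∑-distrib-+ (λ i → sum (E i)) (λ i → sum (λ j → E j i)) ⟩
  sum (λ i → sum (E i)) + sum (λ i → sum (λ j → E j i))
    ≡⟨ cong (sum (λ i → sum (E i)) +_) (∑-comm (λ i j → E j i)) ⟩
  sum (λ i → sum (E i)) + sum (λ i → sum (E i))
    ≡⟨ cong₂ _+_ (edgeCount≡sum G) (trans (+-identityʳ _) (edgeCount≡sum G)) ⟨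
  2 * edgeCount G ∎
  where
  open ≤-Reasoning
  E = orderedEdge G

degree-mono : ∀ {m n} {U : Graph m} {G : Graph n} ((f , _) : Contains U G) →
  ∀ v → degree G v ≤ degree U (f v)
degree-mono {U = U} {G} (f , f-inj , f-hom) v =
  sum-≤-injection f (λ w → 𝟙 (adj G v w)) (λ y → 𝟙 (adj U (f v) y)) (λ _ _ → f-inj) edge↦edge
  where
  edge↦edge : ∀ w → 𝟙 (adj G v w) ≤ 𝟙 (adj U (f v) (f w))
  edge↦edge w with adj G v w in v~w
  ... | false = z≤n
  ... | true rewrite f-hom v w v~w = ≤-refl

countDeg≥ : ∀ {n} → ℕ → Graph n → ℕ
countDeg≥ s G = sum λ v → 𝟙[ s ≤? degree G v ]

𝟙-≤?-mono : ∀ s {d e} → d ≤ e → 𝟙[ s ≤? d ] ≤ 𝟙[ s ≤? e ]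
𝟙-≤?-mono s {d} {e} d≤e with s ≤? d | s ≤? e
... | no  _   | _       = z≤n
... | yes _   | yes _   = ≤-refl
... | yes s≤d | no  s≰e = contradiction (≤-trans s≤d d≤e) s≰e

countDeg≥-mono : ∀ {m n} s {U : Graph m} {G : Graph n} → Contains U G → countDeg≥ s G ≤ countDeg≥ s U
countDeg≥-mono s {U} {G} C@(f , f-inj , _) =
  sum-≤-injection f _ _ (λ _ _ → f-inj) (λ v → 𝟙-≤?-mono s (degree-mono {U = U} {G} C v))

scaleWeight : ℕ → ℕ → ℕ
scaleWeight d i = 2 ^ i * 𝟙[ 2 ^ suc i ≤? d ]

-- The scales counted are a, …, i − 1 where 2^i ≤ d < 2^(i+1); they contribute 2^a + … + 2^(i−1) = 2^i − 2^a.
sum-scaleWeight≤ : ∀ X a d → sum {X} (λ j → scaleWeight d (a + toℕ j)) ≤ d ∸ 2 ^ a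
sum-scaleWeight≤ zero    a d = z≤n
sum-scaleWeight≤ (suc X) a d = begin
  scaleWeight d (a + 0) + sum {X} (λ j → scaleWeight d (a + suc (toℕ j)))
    ≡⟨ cong₂ _+_ (cong (scaleWeight d) (+-identityʳ a))
                 (sum-cong-≗ {X} (λ j → cong (scaleWeight d) (+-suc a (toℕ j)))) ⟩
  scaleWeight d a + sum {X} (λ j → scaleWeight d (suc a + toℕ j))
    ≤⟨ +-monoʳ-≤ (scaleWeight d a) (sum-scaleWeight≤ X (suc a) d) ⟩
  scaleWeight d a + (d ∸ 2 ^ suc a)
    ≤⟨ first+rest ⟩
  d ∸ 2 ^ a ∎
  where
  open ≤-Reasoning
  first+rest : scaleWeight d a + (d ∸ 2 ^ suc a) ≤ d ∸ 2 ^ a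
  first+rest with 2 ^ suc a ≤? d
  ... | yes 2ᵃ⁺¹≤d = ≤-reflexive (begin-equality
    x * 1 + (d ∸ (x + (x + 0))) ≡⟨ cong₂ (λ y z → y + (d ∸ (x + z))) (*-identityʳ x) (+-identityʳ x) ⟩
    x + (d ∸ (x + x))           ≡⟨ cong (x +_) (∸-+-assoc d x x) ⟨
    x + (d ∸ x ∸ x)             ≡⟨ m+[n∸m]≡n (m+n≤o⇒m≤o∸n x (subst (_≤ d) (cong (x +_) (+-identityʳ x)) 2ᵃ⁺¹≤d)) ⟩
    d ∸ x ∎)
    where x = 2 ^ a
  ... | no  _ = begin
    2 ^ a * 0 + (d ∸ 2 ^ suc a) ≡⟨ cong (_+ (d ∸ 2 ^ suc a)) (*-zeroʳ (2 ^ a)) ⟩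
    d ∸ 2 ^ suc a               ≤⟨ ∸-monoʳ-≤ d (^-monoʳ-≤ 2 (n≤1+n a)) ⟩
    d ∸ 2 ^ a ∎

sum-scales≤sum-degree : ∀ {m} X a (U : Graph m) →
  sum {X} (λ j → 2 ^ (a + toℕ j) * countDeg≥ (2 ^ suc (a + toℕ j)) U) ≤ sum (degree U)
sum-scales≤sum-degree X a U = begin
  sum {X} (λ j → 2 ^ i j * countDeg≥ (2 ^ suc (i j)) U)
    ≡⟨ sum-cong-≗ {X} (λ j → *-distribˡ-sum (2 ^ i j) (λ v → 𝟙[ 2 ^ suc (i j) ≤? degree U v ])) ⟩
  sum {X} (λ j → sum (λ v → scaleWeight (degree U v) (i j)))
    ≡⟨ ∑-comm (λ j v → scaleWeight (degree U v) (i j)) ⟩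
  sum (λ v → sum {X} (λ j → scaleWeight (degree U v) (i j)))
    ≤⟨ sum-mono-≤ (λ v → ≤-trans (sum-scaleWeight≤ X a (degree U v)) (m∸n≤m (degree U v) (2 ^ a))) ⟩
  sum (degree U) ∎
  where
  open ≤-Reasoning
  i : Fin X → ℕ
  i j = a + toℕ j

module _ {n} {R : Fin n → Fin n → Set} (R? : Decidable R) (R-sym : Symmetric R) (R-irrefl : ∀ {u} → ¬ R u u) where

  relGraph : Graph n
  relGraph = record
    { adj    = λ u v → does (R? u v)
    ; sym    = does-sym
    ; irrefl = λ u → dec-false (R? u u) R-irrefl
    }
    where
    does-sym : ∀ u v → does (R? u v) ≡ does (R? v u)
    does-sym u v with R? u v | R? v u
    ... | yes _   | yes _    = refl
    ... | no  _   | no  _    = refl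
    ... | yes uRv | no ¬vRu  = contradiction (R-sym uRv) ¬vRu
    ... | no ¬uRv | yes vRu  = contradiction (R-sym vRu) ¬uRv

  R⇒Adj : ∀ {u v} → R u v → Adj relGraph u v
  R⇒Adj {u} {v} = dec-true (R? u v)

  Adj⇒R : ∀ {u v} → Adj relGraph u v → R u v
  Adj⇒R {u} {v} = does⇒witness (R? u v)

Adj-sym : ∀ {n} (G : Graph n) {u v} → Adj G u v → Adj G v u
Adj-sym G {u} {v} u~v = trans (Graph.sym G v u) u~v

Walk-snoc : ∀ {n} {G : Graph n} {P u v w} → Walk G P u v → P w → Adj G v w → Walk G P u w
Walk-snoc (here Pu)          Pw v~w = step Pu v~w (here Pw)
Walk-snoc (step Pu u~u′ u′⇝v) Pw v~w = step Pu u~u′ (Walk-snoc u′⇝v Pw v~w)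

Walk-reverse : ∀ {n} {G : Graph n} {P u v} → Walk G P u v → Walk G P v u
Walk-reverse         (here Pu)           = here Pu
Walk-reverse {G = G} (step Pu u~u′ u′⇝v) = Walk-snoc (Walk-reverse u′⇝v) Pu (Adj-sym G u~u′)

TwoCycleNeighbours : ∀ {n} (G : Graph n) {m} → (Fin m → Fin n) → Fin m → Set
TwoCycleNeighbours G {m} c a = Σ (Fin m) λ p → Σ (Fin m) λ s → p ≢ s × Adj G (c a) (c p) × Adj G (c a) (c s)

cycle-neighbours : ∀ {n} {G : Graph n} {r} {c : Fin (3 + r) → Fin n} →
  (∀ (i : Fin (2 + r)) → Adj G (c (inject₁ i)) (c (suc i))) → Adj G (c (fromℕ (2 + r))) (c zero) →
  ∀ a → TwoCycleNeighbours G c a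
cycle-neighbours {G = G} {r} cyc last zero = fromℕ (2 + r) , suc zero , (λ ()) , Adj-sym G last , cyc zero
cycle-neighbours {G = G} {r} {c} cyc last (suc a) with suc r ≟ toℕ a
... | yes r+1≡a = inject₁ a , zero , p≢0 , Adj-sym G (cyc a) , subst (λ x → Adj G (c x) (c zero)) (sym a+1≡last) last
  where
  p≢0 : inject₁ a ≢ zero
  p≢0 e = 0≢1+n (trans (sym (cong toℕ e)) (trans (Finₚ.toℕ-inject₁ a) (sym r+1≡a)))
  a+1≡last : suc a ≡ fromℕ (2 + r)
  a+1≡last = Finₚ.toℕ-injective (trans (cong suc (sym r+1≡a)) (sym (Finₚ.toℕ-fromℕ (2 + r))))
... | no r+1≢a = inject₁ a , suc (suc l) , p≢s , Adj-sym G (cyc a) ,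
                 subst (λ x → Adj G (c (suc x)) (c (suc (suc l)))) (Finₚ.inject₁-lower₁ a r+1≢a) (cyc (suc l))
  where
  l = lower₁ a r+1≢a
  p≢s : inject₁ a ≢ suc (suc l)
  p≢s e = m≢1+n+m (toℕ a) {1} (trans (sym (Finₚ.toℕ-inject₁ a))
                                 (trans (cong toℕ e) (cong (λ x → suc (suc x)) (Finₚ.toℕ-lower₁ a r+1≢a))))

module PathGraph (n : ℕ) where

  Consecutive : Fin n → Fin n → Set
  Consecutive x y = suc (toℕ x) ≡ toℕ y ⊎ suc (toℕ y) ≡ toℕ x

  consecutive? : Decidable Consecutive
  consecutive? x y = (suc (toℕ x) ≟ toℕ y) ⊎-dec (suc (toℕ y) ≟ toℕ x)

  consecutive-irrefl : ∀ {x} → ¬ Consecutive x x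
  consecutive-irrefl (inj₁ e) = 1+n≢n e
  consecutive-irrefl (inj₂ e) = 1+n≢n e

  path : Graph n
  path = relGraph consecutive? Sum.swap consecutive-irrefl

  consecutive⇒Adj : ∀ {x y} → Consecutive x y → Adj path x y
  consecutive⇒Adj = R⇒Adj consecutive? Sum.swap consecutive-irrefl

  Adj⇒consecutive : ∀ {x y} → Adj path x y → Consecutive x y
  Adj⇒consecutive = Adj⇒R consecutive? Sum.swap consecutive-irrefl

  IntervalClosed : (Fin n → Set) → Set
  IntervalClosed P = ∀ {x y z} → toℕ x ≤ toℕ z → toℕ z ≤ toℕ y → P x → P y → P z

  module _ {P : Fin n → Set} (closed : IntervalClosed P) where

    path-walk-upward : ∀ d {x y} → toℕ x + d ≡ toℕ y → P x → P y → Walk path P x y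
    path-walk-upward zero {x} x+0≡y Px Py with refl ← Finₚ.toℕ-injective (trans (sym (+-identityʳ (toℕ x))) x+0≡y) =
      here Px
    path-walk-upward (suc d) {x} {y} x+d+1≡y Px Py =
      step Px (consecutive⇒Adj (inj₁ (sym x′≡x+1))) (path-walk-upward d x′+d≡y Px′ Py)
      where
      x+1<n : suc (toℕ x) < n
      x+1<n = ≤-<-trans (≤-trans (s≤s (m≤m+n (toℕ x) d)) (≤-reflexive (trans (sym (+-suc (toℕ x) d)) x+d+1≡y)))
                        (Finₚ.toℕ<n y)
      x′ = fromℕ< x+1<n
      x′≡x+1 : toℕ x′ ≡ suc (toℕ x)
      x′≡x+1 = Finₚ.toℕ-fromℕ< x+1<n
      x′+d≡y : toℕ x′ + d ≡ toℕ y
      x′+d≡y = trans (cong (_+ d) x′≡x+1) (trans (sym (+-suc (toℕ x) d)) x+d+1≡y)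
      Px′ : P x′
      Px′ = closed (≤-trans (n≤1+n _) (≤-reflexive (sym x′≡x+1))) (≤-trans (m≤m+n _ d) (≤-reflexive x′+d≡y)) Px Py

    path-walk : ∀ {x y} → P x → P y → Walk path P x y
    path-walk {x} {y} Px Py with ≤-total (toℕ x) (toℕ y)
    ... | inj₁ x≤y = path-walk-upward (toℕ y ∸ toℕ x) (m+[n∸m]≡n x≤y) Px Py
    ... | inj₂ y≤x = Walk-reverse (path-walk-upward (toℕ x ∸ toℕ y) (m+[n∸m]≡n y≤x) Py Px)

  -- At the cycle vertex of largest label, both cycle neighbours must carry the label one below.
  path-acyclic : ¬ HasCycle path
  path-acyclic (r , c , c-inj , cyc , last) = lower-neighbours-coincide (cycle-neighbours {G = path} {r} {c} cyc last top)
    where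
    label : Fin (3 + r) → ℕ
    label j = toℕ (c j)
    top : Fin (3 + r)
    top = argmax label zero (allFin (3 + r))
    top-max : ∀ j → label j ≤ label top
    top-max j = All.lookup (f[xs]≤f[argmax] {f = label} zero (allFin (3 + r))) (∈-allFin j)
    below : ∀ {w} → Consecutive (c top) w → toℕ w ≤ label top → suc (toℕ w) ≡ label top
    below (inj₁ top+1≡w) w≤top = contradiction w≤top (<⇒≱ (≤-reflexive top+1≡w))
    below (inj₂ w+1≡top) _     = w+1≡top
    lower-neighbours-coincide : ¬ TwoCycleNeighbours path c top
    lower-neighbours-coincide (p , s , p≢s , top~p , top~s) =
      p≢s (c-inj (Finₚ.toℕ-injective (suc-injective
        (trans (below (Adj⇒consecutive top~p) (top-max p)) (sym (below (Adj⇒consecutive top~s) (top-max s)))))))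

  path-isTree : IsTree path
  path-isTree = (λ u v → path-walk (λ _ _ _ _ → tt) tt tt) , path-acyclic

module _ {n} .{{_ : NonZero n}} where

  [m*n+o]%n≡o : ∀ m {o} → o < n → (m * n + o) % n ≡ o
  [m*n+o]%n≡o m {o} o<n = trans (cong (_% n) (+-comm (m * n) o)) (trans ([m+kn]%n≡m%n o m n) (m<n⇒m%n≡m o<n))

  [m*n+o]/n≡m : ∀ m {o} → o < n → (m * n + o) / n ≡ m
  [m*n+o]/n≡m m {o} o<n = begin
    (m * n + o) / n   ≡⟨ +-distrib-/ (m * n) o (subst (_< n) (sym (cong₂ _+_ (m*n%n≡0 m n) (m<n⇒m%n≡m o<n))) o<n) ⟩
    m * n / n + o / n ≡⟨ cong₂ _+_ (m*n/n≡m m n) (m<n⇒m/n≡0 o<n) ⟩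
    m + 0             ≡⟨ +-identityʳ m ⟩
    m ∎
    where open ≡-Reasoning

  %-/-injective : ∀ {x y} → x % n ≡ y % n → x / n ≡ y / n → x ≡ y
  %-/-injective {x} {y} x%n≡y%n x/n≡y/n = begin
    x                 ≡⟨ m≡m%n+[m/n]*n x n ⟩
    x % n + x / n * n ≡⟨ cong₂ (λ r β → r + β * n) x%n≡y%n x/n≡y/n ⟩
    y % n + y / n * n ≡⟨ m≡m%n+[m/n]*n y n ⟨
    y ∎
    where open ≡-Reasoning

n≤2*[n/b*b] : ∀ n b .{{_ : NonZero b}} → b ≤ n → n ≤ 2 * (n / b * b)
n≤2*[n/b*b] n b b≤n = begin
  n                       ≡⟨ m≡m%n+[m/n]*n n b ⟩
  n % b + n / b * b       ≤⟨ +-monoˡ-≤ (n / b * b) (≤-trans (m%n≤n n b) b≤n/b*b) ⟩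
  n / b * b + n / b * b   ≡⟨ cong (n / b * b +_) (+-identityʳ (n / b * b)) ⟨
  2 * (n / b * b) ∎
  where
  open ≤-Reasoning
  b≤n/b*b : b ≤ n / b * b
  b≤n/b*b = ≤-trans (≤-reflexive (sym (*-identityˡ b))) (*-monoˡ-≤ b (m≥n⇒m/n>0 b≤n))

n<2^n : ∀ n → n < 2 ^ n
n<2^n zero    = z<s
n<2^n (suc n) = begin-strict
  suc n         ≤⟨ n<2^n n ⟩
  2 ^ n         <⟨ m<m+n (2 ^ n) (m^n>0 2 n) ⟩
  2 ^ n + 2 ^ n ≡⟨ cong (2 ^ n +_) (+-identityʳ (2 ^ n)) ⟨
  2 ^ suc n ∎
  where open ≤-Reasoning

2^⌊log₂n⌋≤n : ∀ n → 1 ≤ n → 2 ^ ⌊log₂ n ⌋ ≤ n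
2^⌊log₂n⌋≤n = <-rec (λ n → 1 ≤ n → 2 ^ ⌊log₂ n ⌋ ≤ n) bound
  where
  bound : ∀ n → (∀ {m} → m < n → 1 ≤ m → 2 ^ ⌊log₂ m ⌋ ≤ m) → 1 ≤ n → 2 ^ ⌊log₂ n ⌋ ≤ n
  bound 1             _   _ = ≤-refl
  bound n@(suc (suc m)) rec _ = begin
    2 ^ ⌊log₂ n ⌋                ≡⟨ cong (2 ^_) ⌊log₂n⌋≡1+⌊log₂⌊n/2⌋⌋ ⟩
    2 * 2 ^ ⌊log₂ ⌊ n /2⌋ ⌋      ≤⟨ *-monoʳ-≤ 2 (rec (⌊n/2⌋<n (suc m)) (s≤s z≤n)) ⟩
    ⌊ n /2⌋ + (⌊ n /2⌋ + 0)      ≤⟨ +-monoʳ-≤ ⌊ n /2⌋ (≤-trans (≤-reflexive (+-identityʳ _)) (⌊n/2⌋≤⌈n/2⌉ n)) ⟩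
    ⌊ n /2⌋ + ⌈ n /2⌉            ≡⟨ ⌊n/2⌋+⌈n/2⌉≡n n ⟩
    n ∎
    where
    open ≤-Reasoning
    1≤⌊log₂n⌋ : 1 ≤ ⌊log₂ n ⌋
    1≤⌊log₂n⌋ = ⌊log₂⌋-mono-≤ {2} {n} (s≤s (s≤s z≤n))
    ⌊log₂n⌋≡1+⌊log₂⌊n/2⌋⌋ : ⌊log₂ n ⌋ ≡ suc ⌊log₂ ⌊ n /2⌋ ⌋
    ⌊log₂n⌋≡1+⌊log₂⌊n/2⌋⌋ = trans (sym (m+[n∸m]≡n 1≤⌊log₂n⌋)) (cong suc (sym (⌊log₂⌊n/2⌋⌋≡⌊log₂n⌋∸1 n)))

module BlockGraph (k b n : ℕ) .{{_ : NonZero b}} where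

  block offset : Fin n → ℕ
  block  u = toℕ u / b
  offset u = toℕ u % b

  Head : Fin n → Set
  Head u = offset u < k

  Joined : Fin n → Fin n → Set
  Joined u v = u ≢ v × block u ≡ block v × (Head u ⊎ Head v)

  joined? : Decidable Joined
  joined? u v = ¬? (u ≟ᶠ v) ×-dec (block u ≟ block v) ×-dec (offset u <? k ⊎-dec offset v <? k)

  Joined-sym : Symmetric Joined
  Joined-sym (u≢v , same , heads) = (λ v≡u → u≢v (sym v≡u)) , sym same , Sum.swap heads

  Joined-irrefl : ∀ {u} → ¬ Joined u u
  Joined-irrefl (u≢u , _) = u≢u refl

  blocks : Graph n
  blocks = relGraph joined? Joined-sym Joined-irrefl

  InBag : Fin n → Fin n → Set
  InBag z u = u ≡ z ⊎ (Head u × block u ≡ block z)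

  inBag? : Decidable InBag
  inBag? z u = (u ≟ᶠ z) ⊎-dec ((offset u <? k) ×-dec (block u ≟ block z))

  bag : Fin n → Subset n
  bag z = tabulate λ u → does (inBag? z u)

  InBag⇒∈ : ∀ {z u} → InBag z u → u ∈ bag z
  InBag⇒∈ {z} {u} u∈z = lookup⇒[]= u (bag z) (trans (lookup∘tabulate _ u) (dec-true (inBag? z u) u∈z))

  ∈⇒InBag : ∀ {z u} → u ∈ bag z → InBag z u
  ∈⇒InBag {z} {u} u∈z = does⇒witness (inBag? z u) (trans (sym (lookup∘tabulate _ u)) ([]=⇒lookup u∈z))

  InBag⇒sameBlock : ∀ {z u} → InBag z u → block u ≡ block z
  InBag⇒sameBlock (inj₁ refl)       = refl
  InBag⇒sameBlock (inj₂ (_ , same)) = same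

  block-between : ∀ {v x y z} → toℕ x ≤ toℕ z → toℕ z ≤ toℕ y → InBag x v → InBag y v → block v ≡ block z
  block-between {v} x≤z z≤y v∈x v∈y = ≤-antisym
    (≤-trans (≤-reflexive (InBag⇒sameBlock v∈x)) (/-monoˡ-≤ b x≤z))
    (≤-trans (/-monoˡ-≤ b z≤y) (≤-reflexive (sym (InBag⇒sameBlock v∈y))))

  inBag-intervalClosed : ∀ v → PathGraph.IntervalClosed n (λ z → InBag z v)
  inBag-intervalClosed v x≤z z≤y (inj₁ refl) (inj₁ refl) = inj₁ (Finₚ.toℕ-injective (≤-antisym x≤z z≤y))
  inBag-intervalClosed v x≤z z≤y v∈x@(inj₂ (head , _)) v∈y =
    inj₂ (head , block-between x≤z z≤y v∈x v∈y)
  inBag-intervalClosed v x≤z z≤y v∈x@(inj₁ _) v∈y@(inj₂ (head , _)) =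
    inj₂ (head , block-between x≤z z≤y v∈x v∈y)

  -- z goes to slot 0 and a head at offset ρ to slot ρ + 1; vertices outside the bag land in the junk slot 0.
  slot : Fin n → Fin n → Fin (suc k)
  slot z u with u ≟ᶠ z | offset u <? k
  ... | yes _ | _        = zero
  ... | no  _ | yes ρ<k = suc (fromℕ< ρ<k)
  ... | no  _ | no  _    = zero

  slot-self : ∀ z → slot z z ≡ zero
  slot-self z with z ≟ᶠ z | offset z <? k
  ... | yes _   | _ = refl
  ... | no  z≢z | _ = contradiction refl z≢z

  toℕ-slot-head : ∀ {z u} → u ≢ z → Head u → toℕ (slot z u) ≡ suc (offset u)
  toℕ-slot-head {z} {u} u≢z ρ<k with u ≟ᶠ z | offset u <? k
  ... | yes u≡z | _        = contradiction u≡z u≢z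
  ... | no  _   | yes ρ<k′ = cong suc (Finₚ.toℕ-fromℕ< ρ<k′)
  ... | no  _   | no  ρ≮k  = contradiction ρ<k ρ≮k

  self-or-head : ∀ {z u} → InBag z u → u ≡ z ⊎ (u ≢ z × Head u)
  self-or-head {z} {u} u∈z with u ≟ᶠ z | u∈z
  ... | yes u≡z | _                = inj₁ u≡z
  ... | no  u≢z | inj₁ u≡z         = contradiction u≡z u≢z
  ... | no  u≢z | inj₂ (head , _)  = inj₂ (u≢z , head)

  slot-injective : ∀ {z u v} → InBag z u → InBag z v → slot z u ≡ slot z v → u ≡ v
  slot-injective {z} {u} {v} u∈z v∈z same with self-or-head u∈z | self-or-head v∈z
  ... | inj₁ refl | inj₁ refl = refl
  ... | inj₁ refl | inj₂ (v≢z , hv) =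
    contradiction (trans (cong toℕ (trans (sym (slot-self z)) same)) (toℕ-slot-head v≢z hv)) 0≢1+n
  ... | inj₂ (u≢z , hu) | inj₁ refl =
    contradiction (trans (sym (cong toℕ (trans same (slot-self z)))) (toℕ-slot-head u≢z hu)) 0≢1+n
  ... | inj₂ (u≢z , hu) | inj₂ (v≢z , hv) = Finₚ.toℕ-injective (%-/-injective
    (suc-injective (trans (sym (toℕ-slot-head u≢z hu)) (trans (cong toℕ same) (toℕ-slot-head v≢z hv))))
    (trans (InBag⇒sameBlock u∈z) (sym (InBag⇒sameBlock v∈z))))

  bag-size : ∀ z → ∣ bag z ∣ ≤ suc k
  bag-size z = begin
    ∣ bag z ∣                        ≡⟨ ∣tabulate∣≡sum (λ u → does (inBag? z u)) ⟩
    sum (λ u → 𝟙 (does (inBag? z u))) ≤⟨ sum-≤-injection (slot z) _ (λ _ → 1) slot-injective′ (λ u → 𝟙≤1 _) ⟩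
    sum {suc k} (λ _ → 1)            ≡⟨ sum-const (suc k) 1 ⟩
    suc k * 1                        ≡⟨ *-identityʳ (suc k) ⟩
    suc k ∎
    where
    open ≤-Reasoning
    member : ∀ {u} → 0 < 𝟙 (does (inBag? z u)) → InBag z u
    member {u} = does⇒witness (inBag? z u) ∘ 𝟙-positive
    slot-injective′ : ∀ {u v} → 0 < 𝟙 (does (inBag? z u)) → 0 < 𝟙 (does (inBag? z v)) → slot z u ≡ slot z v → u ≡ v
    slot-injective′ u∈z v∈z = slot-injective (member u∈z) (member v∈z)

  ∈bag-intervalClosed : ∀ v → PathGraph.IntervalClosed n (λ z → v ∈ bag z)
  ∈bag-intervalClosed v x≤z z≤y v∈x v∈y = InBag⇒∈ (inBag-intervalClosed v x≤z z≤y (∈⇒InBag v∈x) (∈⇒InBag v∈y))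

  edge-covered : ∀ u v → Adj blocks u v → Σ (Fin n) λ x → u ∈ bag x × v ∈ bag x
  edge-covered u v u~v with Adj⇒R joined? Joined-sym Joined-irrefl u~v
  ... | _ , same , inj₁ head-u = v , InBag⇒∈ (inj₂ (head-u , same)) , InBag⇒∈ (inj₁ refl)
  ... | _ , same , inj₂ head-v = u , InBag⇒∈ (inj₁ refl) , InBag⇒∈ (inj₂ (head-v , sym same))

  decomposition : TreeDecomposition k blocks
  decomposition = record
    { t         = n
    ; T         = path
    ; isTree    = path-isTree
    ; bag       = bag
    ; bagSize   = bag-size
    ; vertexCov = λ v → v , InBag⇒∈ (inj₁ refl)
    ; edgeCov   = edge-covered
    ; coherent  = λ v x y → path-walk (∈bag-intervalClosed v)
    }
    where open PathGraph n

  q : ℕ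
  q = n / b

  β*b+ρ<n : ∀ {β ρ} → β < q → ρ < b → β * b + ρ < n
  β*b+ρ<n {β} {ρ} β<q ρ<b = begin-strict
    β * b + ρ <⟨ +-monoʳ-< (β * b) ρ<b ⟩
    β * b + b ≡⟨ +-comm (β * b) b ⟩
    suc β * b ≤⟨ *-monoˡ-≤ b β<q ⟩
    q * b     ≤⟨ m/n*n≤m n b ⟩
    n ∎
    where open ≤-Reasoning

  vertex : ∀ {β ρ} → β < q → ρ < b → Fin n
  vertex β<q ρ<b = fromℕ< (β*b+ρ<n β<q ρ<b)

  block-vertex : ∀ {β ρ} (β<q : β < q) (ρ<b : ρ < b) → block (vertex β<q ρ<b) ≡ β
  block-vertex {β} β<q ρ<b = trans (cong (_/ b) (Finₚ.toℕ-fromℕ< _)) ([m*n+o]/n≡m β ρ<b)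

  offset-vertex : ∀ {β ρ} (β<q : β < q) (ρ<b : ρ < b) → offset (vertex β<q ρ<b) ≡ ρ
  offset-vertex {β} β<q ρ<b = trans (cong (_% b) (Finₚ.toℕ-fromℕ< _)) ([m*n+o]%n≡o β ρ<b)

  module _ (k≤b : k ≤ b) where

    head-degree : ∀ {β ρ} (β<q : β < q) (ρ<k : ρ < k) → b ∸ k ≤ degree blocks (vertex β<q (<-≤-trans ρ<k k≤b))
    head-degree {β} {ρ} β<q ρ<k = injection⇒≤sum non-head (λ w → 𝟙 (adj blocks h w)) non-head-injective joined
      where
      ρ<b = <-≤-trans ρ<k k≤b
      h = vertex β<q ρ<b
      k+p<b : ∀ (p : Fin (b ∸ k)) → k + toℕ p < b
      k+p<b p = <-≤-trans (+-monoʳ-< k (Finₚ.toℕ<n p)) (≤-reflexive (m+[n∸m]≡n k≤b))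
      non-head : Fin (b ∸ k) → Fin n
      non-head p = vertex β<q (k+p<b p)
      non-head-injective : ∀ {p p′} → non-head p ≡ non-head p′ → p ≡ p′
      non-head-injective {p} {p′} e = Finₚ.toℕ-injective (+-cancelˡ-≡ k _ _
        (trans (sym (offset-vertex β<q (k+p<b p))) (trans (cong offset e) (offset-vertex β<q (k+p<b p′)))))
      joined : ∀ p → 1 ≤ 𝟙 (adj blocks h (non-head p))
      joined p = ≤-reflexive (cong 𝟙 (sym (R⇒Adj joined? Joined-sym Joined-irrefl (h≢p , same-block , inj₁ head))))
        where
        head : Head h
        head = subst (_< k) (sym (offset-vertex β<q ρ<b)) ρ<k
        h≢p : h ≢ non-head p
        h≢p e = <⇒≱ head (≤-trans (m≤m+n k (toℕ p)) (≤-reflexive (sym (trans (cong offset e) (offset-vertex β<q (k+p<b p))))))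
        same-block : block h ≡ block (non-head p)
        same-block = trans (block-vertex β<q ρ<b) (sym (block-vertex β<q (k+p<b p)))

    heads-count : ∀ {s} → s ≤ b ∸ k → q * k ≤ countDeg≥ s blocks
    heads-count {s} s≤b∸k =
      injection⇒≤sum head _ head-injective (λ x → 1≤𝟙[ s ≤? _ ] (≤-trans s≤b∸k (head-degree (β<q x) (ρ<k x))))
      where
      block-and-offset : Fin (q * k) → Fin q × Fin k
      block-and-offset = remQuot {q} k
      β<q : ∀ x → toℕ (proj₁ (block-and-offset x)) < q
      β<q x = Finₚ.toℕ<n (proj₁ (block-and-offset x))
      ρ<k : ∀ x → toℕ (proj₂ (block-and-offset x)) < k
      ρ<k x = Finₚ.toℕ<n (proj₂ (block-and-offset x))
      ρ<b : ∀ x → toℕ (proj₂ (block-and-offset x)) < b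
      ρ<b x = <-≤-trans (ρ<k x) k≤b
      head : Fin (q * k) → Fin n
      head x = vertex (β<q x) (ρ<b x)
      head-injective : ∀ {x y} → head x ≡ head y → x ≡ y
      head-injective {x} {y} e = begin
        x                                    ≡⟨ Finₚ.combine-remQuot {q} k x ⟨
        uncurry combine (block-and-offset x) ≡⟨ cong (uncurry combine) (cong₂ _,_
          (Finₚ.toℕ-injective (trans (sym (block-vertex (β<q x) (ρ<b x))) (trans (cong block e) (block-vertex (β<q y) (ρ<b y)))))
          (Finₚ.toℕ-injective (trans (sym (offset-vertex (β<q x) (ρ<b x))) (trans (cong offset e) (offset-vertex (β<q y) (ρ<b y)))))) ⟩
        uncurry combine (block-and-offset y) ≡⟨ Finₚ.combine-remQuot {q} k y ⟩
        y ∎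
        where open ≡-Reasoning

one-scale-bound : ∀ {k n m} i (U : Graph m) → k ≤ 2 ^ suc i → 2 ^ (2 + i) ≤ n → Universal k n U →
  k * n ≤ 8 * (2 ^ i * countDeg≥ (2 ^ suc i) U)
one-scale-bound {k} {n} i U k≤2ˢ b≤n universal = begin
  k * n                                      ≤⟨ *-monoʳ-≤ k (n≤2*[n/b*b] n b b≤n) ⟩
  k * (2 * (q * (2 * (2 * 2 ^ i))))          ≡⟨ rearrange k q (2 ^ i) ⟩
  8 * (2 ^ i * (q * k))                      ≤⟨ *-monoʳ-≤ 8 (*-monoʳ-≤ (2 ^ i) (heads-count k≤b s≤b∸k)) ⟩
  8 * (2 ^ i * countDeg≥ (2 ^ suc i) blocks)
    ≤⟨ *-monoʳ-≤ 8 (*-monoʳ-≤ (2 ^ i) (countDeg≥-mono (2 ^ suc i) {U} {blocks} (universal blocks decomposition))) ⟩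
  8 * (2 ^ i * countDeg≥ (2 ^ suc i) U) ∎
  where
  open ≤-Reasoning
  b = 2 ^ (2 + i)
  instance
    b≢0 : NonZero b
    b≢0 = m^n≢0 2 (2 + i)
  open BlockGraph k b n
  rearrange : ∀ k q x → k * (2 * (q * (2 * (2 * x)))) ≡ 8 * (x * (q * k))
  rearrange = solve-∀
  2ˢ⁺2ˢ≡b : 2 ^ suc i + 2 ^ suc i ≡ b
  2ˢ⁺2ˢ≡b = cong (2 ^ suc i +_) (sym (+-identityʳ (2 ^ suc i)))
  k≤b : k ≤ b
  k≤b = ≤-trans k≤2ˢ (≤-trans (m≤m+n _ _) (≤-reflexive 2ˢ⁺2ˢ≡b))
  s≤b∸k : 2 ^ suc i ≤ b ∸ k
  s≤b∸k = m+n≤o⇒m≤o∸n (2 ^ suc i) (≤-trans (+-monoʳ-≤ (2 ^ suc i) k≤2ˢ) (≤-reflexive 2ˢ⁺2ˢ≡b))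

all-scales-bound : ∀ {k n m} X (U : Graph m) → 2 ^ suc (k + X) ≤ n → Universal k n U →
  X * (k * n) ≤ 16 * edgeCount U
all-scales-bound {k} {n} X U 2^[k+X+1]≤n universal = begin
  X * (k * n)           ≡⟨ sum-const X (k * n) ⟨
  sum {X} (λ _ → k * n) ≤⟨ sum-mono-≤ (λ j → one-scale-bound (k + toℕ j) U (k≤2^[k+j+1] j) (2^[k+j+2]≤n j) universal) ⟩
  sum {X} (λ j → 8 * term j)
    ≡⟨ *-distribˡ-sum 8 term ⟨
  8 * sum term          ≤⟨ *-monoʳ-≤ 8 (≤-trans (sum-scales≤sum-degree X k U) (sum-degree≤2*edgeCount U)) ⟩
  8 * (2 * edgeCount U) ≡⟨ *-assoc 8 2 (edgeCount U) ⟨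
  16 * edgeCount U ∎
  where
  open ≤-Reasoning
  term : Fin X → ℕ
  term j = 2 ^ (k + toℕ j) * countDeg≥ (2 ^ suc (k + toℕ j)) U
  k≤2^[k+j+1] : ∀ j → k ≤ 2 ^ suc (k + toℕ j)
  k≤2^[k+j+1] j = ≤-trans (<⇒≤ (n<2^n k)) (^-monoʳ-≤ 2 (≤-trans (m≤m+n k (toℕ j)) (n≤1+n _)))
  2^[k+j+2]≤n : ∀ j → 2 ^ (2 + (k + toℕ j)) ≤ n
  2^[k+j+2]≤n j = ≤-trans (^-monoʳ-≤ 2 (s≤s k+j+1≤k+X)) 2^[k+X+1]≤n
    where
    k+j+1≤k+X : suc (k + toℕ j) ≤ k + X
    k+j+1≤k+X = subst (_≤ k + X) (+-suc k (toℕ j)) (+-monoʳ-≤ k (Finₚ.toℕ<n j))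

edgeCount-lower-bound : ∀ k n → 2 ^ (2 * k + 2) ≤ n → ∀ {m} (U : Graph m) → Universal k n U →
  k * n * ⌊log₂ n ⌋ ≤ 32 * edgeCount U
edgeCount-lower-bound k n 2^[2k+2]≤n U universal = begin
  k * n * L           ≤⟨ *-monoʳ-≤ (k * n) L≤2X ⟩
  k * n * (2 * X)     ≡⟨ rearrange k n X ⟩
  2 * (X * (k * n))   ≤⟨ *-monoʳ-≤ 2 (all-scales-bound X U 2^[k+X+1]≤n universal) ⟩
  2 * (16 * edgeCount U) ≡⟨ *-assoc 2 16 (edgeCount U) ⟨
  32 * edgeCount U ∎
  where
  open ≤-Reasoning
  L = ⌊log₂ n ⌋
  X = L ∸ suc k
  rearrange : ∀ k n X → k * n * (2 * X) ≡ 2 * (X * (k * n))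
  rearrange = solve-∀
  2k+2≤L : suc k + suc k ≤ L
  2k+2≤L = subst₂ _≤_ (trans (⌊log₂[2^n]⌋≡n (2 * k + 2)) (2k+2≡[k+1]+[k+1] k)) refl (⌊log₂⌋-mono-≤ 2^[2k+2]≤n)
    where
    2k+2≡[k+1]+[k+1] : ∀ k → 2 * k + 2 ≡ suc k + suc k
    2k+2≡[k+1]+[k+1] = solve-∀
  X+k+1≡L : X + suc k ≡ L
  X+k+1≡L = m∸n+n≡m (≤-trans (m≤m+n (suc k) (suc k)) 2k+2≤L)
  L≤2X : L ≤ 2 * X
  L≤2X = begin
    L           ≡⟨ X+k+1≡L ⟨
    X + suc k   ≤⟨ +-monoʳ-≤ X (+-cancelʳ-≤ (suc k) (suc k) X (subst (suc k + suc k ≤_) (sym X+k+1≡L) 2k+2≤L)) ⟩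
    X + X       ≡⟨ cong (X +_) (+-identityʳ X) ⟨
    2 * X ∎
  2^[k+X+1]≤n : 2 ^ suc (k + X) ≤ n
  2^[k+X+1]≤n = subst (λ e → 2 ^ e ≤ n) (trans (sym X+k+1≡L) (trans (+-suc X k) (cong suc (+-comm X k))))
                      (2^⌊log₂n⌋≤n n (≤-trans (m^n>0 2 (2 * k + 2)) 2^[2k+2]≤n))

theorem4p1 : Σ ℕ λ p → Σ ℕ λ q → (0 < p) × (0 < q) ×
    (∀ k → 1 ≤ k → Σ ℕ λ N → ∀ n → N ≤ n →
      ∀ m (U : Graph m) → Universal k n U →
        p * k * n * ⌊log₂ n ⌋ ≤ q * edgeCount U)
-- The argument does not need 1 ≤ k.
theorem4p1 = 1 , 32 , z<s , z<s , λ k _ → 2 ^ (2 * k + 2) , λ n N≤n m U universal →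
  subst (_≤ 32 * edgeCount U) (cong (λ k′ → k′ * n * ⌊log₂ n ⌋) (sym (*-identityˡ k)))
    (edgeCount-lower-bound k n N≤n U universal)
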